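{- Let $A$ be an $\varepsilon$NFA and $w\in\Sigma^*$. If $\mathrm{cond}(A_{\mathrm{sup}})$ has a transition $(C,b,C')$ for some $b\in\Sigma$, then it also has a transition $(C,\varepsilon,C')$. Further, if $S_0,S_1,\dots,S_{|w|}$ are the state sets of the state-set simulation of $\mathrm{cond}(A_{\mathrm{sup}})$ on $w$, then $S_0\supseteq S_1\supseteq\dots\supseteq S_{|w|}$ and $S_0$ contains all states of $\mathrm{cond}(A_{\mathrm{sup}})$.
   Context: An $\varepsilon$NFA is a tuple $A=(Q,\Sigma,q_0,q_f,\delta)$ with $\delta\subseteq Q\times(\Sigma\cup\{\varepsilon\})\times Q$. Standing assumption: $A$ is trimmed (every state is reachable from $q_0$ and can reach $q_f$). $A_{\mathrm{sup}}$ is obtained from $A$ by adding a transition $(p,\varepsilon,q)$ for every transition $(p,b,q)$ of $A$ with $b\in\Sigma$. For an $\varepsilon$NFA $B$, the condensation $\mathrm{cond}(B)$ has the strongly connected components of $B$ (as a directed graph) as states, a transition $(\mathrm{SCC}_B[p],a,\mathrm{SCC}_B[q])$ for each transition $(p,a,q)$ of $B$ (where $\mathrm{SCC}_B[p]$ is the SCC containing $p$), initial state $\mathrm{SCC}_B[q_0]$ and final state $\mathrm{SCC}_B[q_f]$. State-set simulation of an $\varepsilon$NFA $B$ with initial state $s$ on $w$: $S_0=\mathrm{C}_\varepsilon(\{s\})$ and $S_i=\mathrm{C}_\varepsilon(\mathrm{C}_{w[i]}(S_{i-1}))$ for $1\le i\le |w|$, where $\mathrm{C}_b(S)=\{q\mid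 p\in S,(p,b,q)\text{ a transition}\}$ and $\mathrm{C}_\varepsilon(S)$ is the set of states reachable from $S$ via paths of $\varepsilon$-transitions. -}

module Defs where

open import Data.Nat using (ℕ; zero; suc; _≤_; _<_)
open import Data.Nat.Properties using (<⇒≤)
open import Data.Fin using (Fin; fromℕ<)
open import Data.Maybe using (Maybe; just; nothing)
open import Data.List using (List; length; lookup)
open import Data.Product using (Σ; ∃; _×_; _,_)
open import Relation.Binary.Construct.Closure.ReflexiveTransitive using (Star)

-- An εNFA over alphabet Σ with finitely many states Fin n.
-- Labels are Maybe Σ : 'nothing' is ε, 'just b' is the letter b.
-- The transition relation δ ⊆ Q × (Σ ∪ {ε}) × Q is given as a relation.
record εNFA (Σ : Set) : Set₁ where
  field
    n   : ℕ
    q₀  : Fin n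
    q_f : Fin n
    δ   : Fin n → Maybe Σ → Fin n → Set
open εNFA public

module _ {Σ : Set} (B : εNFA Σ) where

  Edge : Fin (n B) → Fin (n B) → Set
  Edge = λ p q → ∃ λ a → δ B p a q

  Reach : Fin (n B) → Fin (n B) → Set
  Reach = Star Edge

  Trimmed : Set
  Trimmed = ∀ q → Reach (q₀ B) q × Reach q (q_f B)

  SameSCC : Fin (n B) → Fin (n B) → Set
  SameSCC = λ p q → Reach p q × Reach q p

data SupTrans {Σ : Set} (A : εNFA Σ) : Fin (n A) → Maybe Σ → Fin (n A) → Set where
  orig  : ∀ {p a q} → δ A p a q → SupTrans A p a q
  added : ∀ {p b q} → δ A p (just b) q → SupTrans A p nothing q

Sup : {Σ : Set} → εNFA Σ → εNFA Σ
Sup A = record { n = n A ; q₀ = q₀ A ; q_f = q_f A ; δ = SupTrans A }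

-- Its states (the SCCs of B) are represented by
-- representatives c : Fin n, the SCC of c being SCC_B[c]; two representatives
-- denote the same state of cond(B) iff SameSCC B.
module Cond {Σ : Set} (B : εNFA Σ) where

  State : Set
  State = Fin (n B)

  _≈_ : State → State → Set
  _≈_ = SameSCC B

  Trans : State → Maybe Σ → State → Set
  Trans c a c' = ∃ λ p → ∃ λ q → δ B p a q × (p ≈ c) × (q ≈ c')

  initial final : State
  initial = q₀ B
  final   = q_f B

  StateSet : Set₁
  StateSet = State → Set

  _⊆_ : StateSet → StateSet → Set
  S ⊆ T = ∀ c → S c → T c

  Cb : Maybe Σ → StateSet → StateSet
  Cb b S d = ∃ λ c → S c × Trans c b d

  Cε : StateSet → StateSet
  Cε S d = ∃ λ c → ∃ λ c' → S c × Star (λ x y → Trans x nothing y) c c' × (c' ≈ d)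

  sim : (w : List Σ) → (i : ℕ) → i ≤ length w → StateSet
  sim w zero    _ = Cε (λ c → c ≈ initial)
  sim w (suc i) p = Cε (Cb (just (lookup w (fromℕ< p))) (sim w i (<⇒≤ p)))

-- In A_sup every letter transition (p,b,q) has a parallel ε-transition (p,ε,q), and
-- hence so does every transition of cond(A_sup).  Therefore every path of A_sup, in
-- particular one inside an SCC, is a path of ε-transitions of the condensation.  So
-- C_ε is a closure operator absorbing C_b, which makes the simulation decreasing; and
-- since A is trimmed, every state is ε-reachable from the initial one.
module Submission where

open import Defs
open import Data.Nat using (ℕ; zero; suc; _≤_; z≤n)
open import Data.Nat.Properties using (<⇒≤)
open import Data.Fin using (Fin)
open import Data.Maybe using (just; nothing)
open import Data.List using (List; length)
open import Data.Product using (_×_; _,_; proj₁; proj₂)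
open import Relation.Binary.Construct.Closure.ReflexiveTransitive
  using (Star; ε; _◅_; _◅◅_; map)

-- States are named p, r: the field q_f is a mixfix operator, so q cannot be a variable.
εSaturated : {Σ : Set} → εNFA Σ → Set
εSaturated B = ∀ {p b r} → δ B p (just b) r → δ B p nothing r

Sup-εSaturated : {Σ : Set} (A : εNFA Σ) → εSaturated (Sup A)
Sup-εSaturated A (SupTrans.orig t) = SupTrans.added t

Reach⇒Reach-Sup : {Σ : Set} (A : εNFA Σ) {p r : Fin (n A)} → Reach A p r → Reach (Sup A) p r
Reach⇒Reach-Sup A = map λ { (a , t) → a , SupTrans.orig t }

Sup-trimmed : {Σ : Set} (A : εNFA Σ) → Trimmed A → Trimmed (Sup A)
Sup-trimmed A trimmed r =
  Reach⇒Reach-Sup A (proj₁ (trimmed r)) , Reach⇒Reach-Sup A (proj₂ (trimmed r))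

module Condensation {Σ : Set} (B : εNFA Σ) where
  open Cond B

  εTrans : State → State → Set
  εTrans c d = Trans c nothing d

  ≈-refl : ∀ c → c ≈ c
  ≈-refl c = ε , ε

  Cε-mono : ∀ {S T} → S ⊆ T → Cε S ⊆ Cε T
  Cε-mono S⊆T d (c , c' , Sc , path , c'≈d) = c , c' , S⊆T c Sc , path , c'≈d

  module Saturated (saturated : εSaturated B) where

    Trans-just⇒Trans-nothing : ∀ {c b d} → Trans c (just b) d → εTrans c d
    Trans-just⇒Trans-nothing (p , r , t , p≈c , r≈d) = p , r , saturated t , p≈c , r≈d

    Edge⇒εTrans : ∀ {p r} → Edge B p r → εTrans p r
    Edge⇒εTrans {p} {r} (nothing , t) = p , r , t , ≈-refl p , ≈-refl r
    Edge⇒εTrans {p} {r} (just b  , t) = p , r , saturated t , ≈-refl p , ≈-refl r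

    Reach⇒εReach : ∀ {p r} → Reach B p r → Star εTrans p r
    Reach⇒εReach = map Edge⇒εTrans

    Cb⊆Cε : ∀ b S → Cb (just b) S ⊆ Cε S
    Cb⊆Cε b S d (c , Sc , t) = c , d , Sc , Trans-just⇒Trans-nothing t ◅ ε , ≈-refl d

    Cε-idem : ∀ S → Cε (Cε S) ⊆ Cε S
    Cε-idem S d (c , c' , (x , x' , Sx , path₁ , (x'→c , _)) , path₂ , c'≈d) =
      x , c' , Sx , path₁ ◅◅ Reach⇒εReach x'→c ◅◅ path₂ , c'≈d

    Cε-Cb-Cε⊆Cε : ∀ b S → Cε (Cb (just b) (Cε S)) ⊆ Cε S
    Cε-Cb-Cε⊆Cε b S d inC =
      Cε-idem S d (Cε-idem (Cε S) d (Cε-mono (Cb⊆Cε b (Cε S)) d inC))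

    sim-decreasing : (w : List Σ) (i : ℕ) (p : suc i ≤ length w) →
                     sim w (suc i) p ⊆ sim w i (<⇒≤ p)
    -- Both S_0 and S_(i+1) are C_ε-images, definitionally.
    sim-decreasing w zero    p = Cε-Cb-Cε⊆Cε _ _
    sim-decreasing w (suc i) p = Cε-Cb-Cε⊆Cε _ _

    sim-zero-full : Trimmed B → (w : List Σ) → ∀ c → sim w zero z≤n c
    sim-zero-full trimmed w c =
      initial , c , ≈-refl initial , Reach⇒εReach (proj₁ (trimmed c)) , ≈-refl c

proposition4p5 : {Σ : Set} (A : εNFA Σ) → Trimmed A → (w : List Σ) →
    ((C C' : Cond.State (Sup A)) (b : Σ) → Cond.Trans (Sup A) C (just b) C' → Cond.Trans (Sup A) C nothing C')
    × ((i : ℕ) (p : suc i ≤ length w) → Cond._⊆_ (Sup A) (Cond.sim (Sup A) w (suc i) p) (Cond.sim (Sup A) w i (<⇒≤ p)))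
    × ((C : Cond.State (Sup A)) → Cond.sim (Sup A) w zero z≤n C)
proposition4p5 A trimmed w =
  (λ _ _ _ → Trans-just⇒Trans-nothing) , sim-decreasing w , sim-zero-full (Sup-trimmed A trimmed) w
  where open Condensation.Saturated (Sup A) (Sup-εSaturated A)
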